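{- Let $G$ be a connected graph and consider the game with $k$ cops on $G$, at a state where the cops are at positions $c_1,\dots,c_k$, the robber is at $r$, and it is the cops' turn to move. Let $S=S(R)$ be the robber's safe neighborhood. Suppose there exists $j\in\{1,\dots,k\}$ such that either (a) there is no edge between $S$ and $N'_C(c_j)$, and $G[S]$ is cop-win; or (b) $N(S)\cap N'_C(c_j)=\{v\}$ for a single vertex $v$, the graph $H=G[S\cup\{v\}]$ is cop-win, and $v$ is no-backtrack-winning in $H$. Then the cops have a winning strategy from this state.
   Context: Cops and Robbers: players occupy vertices; on their turn each cop moves to an adjacent vertex or stays (several cops may share a vertex), and on his turn the robber moves to an adjacent vertex or stays; the cops win if a cop occupies the robber's vertex. A graph is cop-win if one cop has a winning strategy. For $v\in V(G)$, $N(v)$ is its neighborhood and $N[v]=N(v)\cup\{v\}$; for $S\subseteq V$, $N[S]=\bigcup_{v\in S}N[v]$ and $N(S)=\bigcup_{v\in S}N(v)\setminus S$. Let $C=\{c_1,\dots,c_k\}$ be the set of cop positions. The robber's safe neighborhood $S(R)$ is the connected component of $G-N[C]$ containing the robber (empty if $r\in N[C]$). For a set $U$ and $u_j\in U$, $N'_U(u_j)=N(u_j)\setminus N[U\setminus\{u_j\}]$ (neighbors of $u_j$ not adjacent to or equal to any other vertex of $U$). In a cop-win graph $H$, a vertex $v$ is no-backtrack-winning if a single cop starting at $v$ has a winning strategy on $H$ in which the cop never occupies a vertex it has previously occupied. -}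

module Defs where

open import Data.Nat using (ℕ)
open import Data.Fin using (Fin)
open import Data.Bool using (Bool; true; false)
open import Data.Product using (Σ; _×_)
open import Data.Sum using (_⊎_)
open import Data.Unit using (⊤)
open import Data.List using (List; []; _∷_)
open import Data.List.Membership.Propositional using (_∉_)
open import Relation.Nullary using (¬_)
open import Relation.Binary.PropositionalEquality using (_≡_; _≢_)

record Graph (n : ℕ) : Set where
  field
    E     : Fin n → Fin n → Bool
    sym   : ∀ u v → E u v ≡ E v u
    irref : ∀ v → E v v ≡ false

module _ {n : ℕ} (G : Graph n) where
  open Graph G

  V : Set
  V = Fin n

  Adj : V → V → Set
  Adj u v = E u v ≡ true

  InN[_] : V → V → Set
  InN[ u ] w = Adj u w ⊎ w ≡ u

  -- Reach Q u v : there is a walk from u to v all of whose vertices satisfy Q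
  -- (i.e. u and v lie in the same component of the subgraph induced by Q).
  data Reach (Q : V → Set) : V → V → Set where
    here : ∀ {u} → Q u → Reach Q u u
    step : ∀ {u w v} → Q u → Adj u w → Reach Q w v → Reach Q u v

  Connected : Set
  Connected = ∀ u v → Reach (λ _ → ⊤) u v

  -- CopsWin P C r : it is the cops' turn, the cops are at C, the robber at r,
  -- and the cops can force capture (in finitely many rounds; for a finite
  -- graph this is the same as having a winning strategy).
  data CopsWin {k : ℕ} (P : V → Set) (C : Fin k → V) (r : V) : Set where
    caught : (i : Fin k) → C i ≡ r → CopsWin P C r
    move   : (C' : Fin k → V)
           → (∀ i → P (C' i))
           → (∀ i → InN[ C i ] (C' i))
           → (Σ (Fin k) (λ i → C' i ≡ r)
              ⊎ (∀ r' → P r' → InN[ r ] r' → CopsWin P C' r'))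
           → CopsWin P C r

  -- The induced subgraph G[P] is cop-win: one cop chooses a start vertex,
  -- then the robber chooses his, then the cop moves first and wins.
  CopWinGraph : (P : V → Set) → Set
  CopWinGraph P = Σ V λ c → P c × (∀ r → P r → CopsWin {k = 1} P (λ _ → c) r)

  -- One-cop game on G[P] where the cop never moves to a vertex it has
  -- previously occupied (hist = list of vertices occupied so far, including
  -- the current one). In particular the cop never stays put.
  data NBWin (P : V → Set) (hist : List V) (c r : V) : Set where
    caught : c ≡ r → NBWin P hist c r
    move   : (c' : V) → P c' → InN[ c ] c' → c' ∉ hist
           → (c' ≡ r ⊎ (∀ r' → P r' → InN[ r ] r' → NBWin P (c' ∷ hist) c' r'))
           → NBWin P hist c r

  NoBacktrackWinning : (P : V → Set) → V → Set
  NoBacktrackWinning P v = P v × (∀ r → P r → NBWin P (v ∷ []) v r)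

  module _ {k : ℕ} (C : Fin k → V) where

    InNC : V → Set
    InNC w = Σ (Fin k) λ i → InN[ C i ] w

    -- Safe neighbourhood S(R): component of G - N[C] containing r
    -- (empty when r ∈ N[C]).
    Safe : V → V → Set
    Safe r w = Reach (λ x → ¬ InNC x) r w

    -- N'_C(c_j) = N(c_j) \ N[C \ {c_j}]  (C read as a set of vertices)
    N' : Fin k → V → Set
    N' j w = Adj (C j) w × (∀ i → C i ≢ C j → ¬ InN[ C i ] w)

  NSet : (V → Set) → V → Set
  NSet S w = (Σ V λ s → S s × Adj s w) × ¬ S w

-- Cop j alone plays a winning one-cop strategy on the robber's safe
-- neighbourhood S while every other cop stays put.  A robber leaving S either
-- moves next to a stationary cop, and is caught at once, or enters
-- N'(c_j).  In case (a) he cannot enter N'(c_j), so cop j walks to the start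
-- of a winning strategy on G[S] and follows it.  In case (b) the only exit is
-- v; cop j steps onto v and follows a no-backtrack winning strategy of
-- G[S ∪ {v}] from there, and a robber standing on the already visited v
-- could never be caught by it, so he never gets there.
module Submission where

open import Defs
open import Data.Nat using (ℕ)
open import Data.Fin using (Fin; zero; _≟_)
open import Data.Fin.Properties using (any?)
open import Data.Bool using (true)
open import Data.Bool.Properties using () renaming (_≟_ to _≟ᵇ_)
open import Data.Product using (Σ; _×_; _,_; proj₁; proj₂)
open import Data.Sum using (_⊎_; inj₁; inj₂; [_,_]′)
open import Data.Unit using (⊤; tt)
open import Data.Empty using (⊥; ⊥-elim)
open import Data.List.Membership.Propositional using (_∈_)
open import Data.List.Relation.Unary.Any using (here; there)
open import Data.Vec.Functional using (updateAt)
open import Data.Vec.Functional.Properties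
  using (updateAt-updates; updateAt-minimal; updateAt-id-local)
open import Function using (id; const; _∘_)
open import Function.Bundles using (_⇔_; Equivalence)
open import Relation.Nullary using (¬_; Dec; yes; no)
open import Relation.Binary.PropositionalEquality
  using (_≡_; _≢_; _≗_; refl; sym; trans; subst; subst₂; cong)

module _ {n : ℕ} (G : Graph n) where
  open Graph G using (E) renaming (sym to E-sym)

  Adj-sym : ∀ {u w} → Adj G u w → Adj G w u
  Adj-sym {u} {w} u~w = trans (E-sym w u) u~w

  InN-dec : ∀ u w → Dec (InN[_] G u w)
  InN-dec u w with E u w ≟ᵇ true | w ≟ u
  ... | yes u~w | _      = yes (inj₁ u~w)
  ... | no _    | yes w≡u = yes (inj₂ w≡u)
  ... | no u≁w  | no w≢u  = no λ { (inj₁ u~w) → u≁w u~w ; (inj₂ w≡u) → w≢u w≡u }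

  InNC-dec : ∀ {k} (C : Fin k → V G) w → Dec (InNC G C w)
  InNC-dec C w = any? λ i → InN-dec (C i) w

  Reach-target : ∀ {Q u w} → Reach G Q u w → Q w
  Reach-target (here Qu)     = Qu
  Reach-target (step _ _ uw) = Reach-target uw

  Reach-snoc : ∀ {Q u w x} → Reach G Q u w → Adj G w x → Q x → Reach G Q u x
  Reach-snoc (here Qw)        w~x Qx = step Qw w~x (here Qx)
  Reach-snoc (step Qu u~u' p) w~x Qx = step Qu u~u' (Reach-snoc p w~x Qx)

  NBWin-visited : ∀ {P hist c w} → NBWin G P hist c w → P w → w ∈ hist → c ≢ w → ⊥
  NBWin-visited (caught c≡w)                      _  _     c≢w = c≢w c≡w
  NBWin-visited (move c' _ _ c'∉hist (inj₁ c'≡w)) _  w∈hist _   =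
    c'∉hist (subst (_∈ _) (sym c'≡w) w∈hist)
  NBWin-visited (move c' _ _ c'∉hist (inj₂ next)) Pw w∈hist _   =
    NBWin-visited (next _ Pw (inj₂ refl)) Pw (there w∈hist)
      λ c'≡w → c'∉hist (subst (_∈ _) (sym c'≡w) w∈hist)

  CopsWin-cong : ∀ {k P} {D D' : Fin k → V G} {ρ} → D ≗ D' → CopsWin G P D ρ → CopsWin G P D' ρ
  CopsWin-cong D≗D' (caught i Di≡ρ)        = caught i (trans (sym (D≗D' i)) Di≡ρ)
  CopsWin-cong D≗D' (move D₁ P₁ legal next) =
    move D₁ P₁ (λ i → subst (λ x → InN[_] G x (D₁ i)) (D≗D' i) (legal i)) next

  updateAt-step : ∀ {k} (D : Fin k → V G) i {x y} → InN[_] G x y →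
                  ∀ i' → InN[_] G (updateAt D i (const x) i') (updateAt D i (const y) i')
  updateAt-step D i x~y i' with i' ≟ i
  ... | yes refl = subst₂ (InN[_] G) (sym (updateAt-updates i D)) (sym (updateAt-updates i D)) x~y
  ... | no i'≢i  = inj₂ (trans (updateAt-minimal i' i D i'≢i) (sym (updateAt-minimal i' i D i'≢i)))

  capture : ∀ {k} (D : Fin k → V G) i {ρ} → InN[_] G (D i) ρ → CopsWin G (λ _ → ⊤) D ρ
  capture D i Di~ρ =
    CopsWin-cong (updateAt-id-local i D refl)
      (move _ (λ _ → tt) (updateAt-step D i Di~ρ) (inj₁ (i , updateAt-updates i D)))

module Shadowing {n k : ℕ} (G : Graph n) (C : Fin k → V G) (j : Fin k) (r : V G) where

  S : V G → Set
  S = Safe G C r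

  cops : V G → Fin k → V G
  cops x = updateAt C j (const x)

  -- Cops standing on c_j's vertex do not guard anything: they would be
  -- irrelevant to N'_C(c_j), where C is read as a set of vertices.
  Guarded : V G → Set
  Guarded w = Σ (Fin k) λ i → C i ≢ C j × InN[_] G (C i) w

  Confines : (V G → Set) → Set
  Confines Q = ∀ {ρ w} → S ρ → InN[_] G ρ w → Q w ⊎ Guarded w

  Guarded-dec : ∀ w → Dec (Guarded w)
  Guarded-dec w = any? λ i → guarded-by i
    where
      guarded-by : ∀ i → Dec (C i ≢ C j × InN[_] G (C i) w)
      guarded-by i with C i ≟ C j | InN-dec G (C i) w
      ... | yes Ci≡Cj | _         = no λ (Ci≢Cj , _) → Ci≢Cj Ci≡Cj
      ... | no Ci≢Cj  | yes Ci~w  = yes (Ci≢Cj , Ci~w)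
      ... | no _      | no Ci≁w   = no (Ci≁w ∘ proj₂)

  confines : ∀ {Q} → (∀ {w} → S w → Q w)
           → (∀ {ρ w} → S ρ → Adj G ρ w → ¬ S w → N' G C j w → Q w)
           → Confines Q
  confines inS exit {ρ} {w} Sρ ρ~w with InNC-dec G C w
  ... | no w∉N[C] = inj₁ (inS (stay-safe ρ~w))
    where
      stay-safe : InN[_] G ρ w → S w
      stay-safe (inj₁ ρ~w) = Reach-snoc G Sρ ρ~w w∉N[C]
      stay-safe (inj₂ w≡ρ) = subst S (sym w≡ρ) Sρ
  ... | yes (i , Ci~w) with Guarded-dec w
  ...   | yes guarded = inj₂ guarded
  ...   | no unguarded with C i ≟ C j
  ...     | no Ci≢Cj  = ⊥-elim (unguarded (i , Ci≢Cj , Ci~w))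
  ...     | yes Ci≡Cj =
    inj₁ (exit Sρ (ρ-adj ρ~w) (λ Sw → Reach-target G Sw (i , Ci~w))
               (Cj-adj Cj~w , λ i' Ci'≢Cj Ci'~w → unguarded (i' , Ci'≢Cj , Ci'~w)))
    where
      ρ∉N[C] : ¬ InNC G C ρ
      ρ∉N[C] = Reach-target G Sρ
      Cj~w : InN[_] G (C j) w
      Cj~w = subst (λ u → InN[_] G u w) Ci≡Cj Ci~w
      ρ-adj : InN[_] G ρ w → Adj G ρ w
      ρ-adj (inj₁ ρ~w) = ρ~w
      ρ-adj (inj₂ w≡ρ) = ⊥-elim (ρ∉N[C] (i , subst (InN[_] G (C i)) w≡ρ Ci~w))
      Cj-adj : InN[_] G (C j) w → Adj G (C j) w
      Cj-adj (inj₁ Cj~w) = Cj~w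
      Cj-adj (inj₂ w≡Cj) = ⊥-elim (ρ∉N[C] (j , inj₁ (Adj-sym G (subst (Adj G ρ) w≡Cj (ρ-adj ρ~w)))))

  guarded-capture : ∀ {x w} → Guarded w → CopsWin G (λ _ → ⊤) (cops x) w
  guarded-capture {x} {w} (i , Ci≢Cj , Ci~w) =
    capture G (cops x) i
      (subst (λ u → InN[_] G u w) (sym (updateAt-minimal i j C (Ci≢Cj ∘ cong C))) Ci~w)

  j-captures : ∀ {x y ρ} → InN[_] G x y → y ≡ ρ → CopsWin G (λ _ → ⊤) (cops x) ρ
  j-captures x~y y≡ρ =
    move _ (λ _ → tt) (updateAt-step G C j x~y) (inj₁ (j , trans (updateAt-updates j C) y≡ρ))

  shadow-step : ∀ {Q x y ρ} → Confines Q → S ρ → InN[_] G x y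
              → (∀ {ρ'} → Q ρ' → InN[_] G ρ ρ' → CopsWin G (λ _ → ⊤) (cops y) ρ')
              → CopsWin G (λ _ → ⊤) (cops x) ρ
  shadow-step conf Sρ x~y next =
    move _ (λ _ → tt) (updateAt-step G C j x~y)
      (inj₂ λ _ _ ρ~ρ' → [ (λ Qρ' → next Qρ' ρ~ρ') , guarded-capture ]′ (conf Sρ ρ~ρ'))

  follow : Confines S → ∀ {c : Fin 1 → V G} {ρ}
         → CopsWin G S c ρ → S ρ → CopsWin G (λ _ → ⊤) (cops (c zero)) ρ
  follow conf (caught zero c≡ρ)                   _  = caught j (trans (updateAt-updates j C) c≡ρ)
  follow conf (move _ _ legal (inj₁ (zero , e)))  _  = j-captures (legal zero) e
  follow conf (move _ _ legal (inj₂ next))        Sρ =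
    shadow-step conf Sρ (legal zero) λ Sρ' ρ~ρ' → follow conf (next _ Sρ' ρ~ρ') Sρ'

  approach : Confines S → ∀ {x c ρ} → Reach G (λ _ → ⊤) x c → S ρ
           → (∀ {ρ'} → S ρ' → CopsWin G (λ _ → ⊤) (cops c) ρ')
           → CopsWin G (λ _ → ⊤) (cops x) ρ
  approach conf (here _)          Sρ win = win Sρ
  approach conf (step _ x~x' path) Sρ win =
    shadow-step conf Sρ (inj₁ x~x') λ Sρ' _ → approach conf path Sρ' win

  cops-win-if-sealed : Connected G → S r
                     → (∀ s w → S s → N' G C j w → ¬ Adj G s w) → CopWinGraph G S
                     → CopsWin G (λ _ → ⊤) (cops (C j)) r
  cops-win-if-sealed conn Sr sealed (c , _ , c-wins) =
    approach conf (conn (C j) c) Sr λ Sρ → follow conf (c-wins _ Sρ) Sρ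
    where
      conf : Confines S
      conf = confines id λ Sρ ρ~w _ N'w → ⊥-elim (sealed _ _ Sρ N'w ρ~w)

  module _ (v : V G) where

    H : V G → Set
    H x = S x ⊎ x ≡ v

    follow-nb : Confines H → ∀ {hist x ρ}
              → NBWin G H hist x ρ → v ∈ hist → H ρ → CopsWin G (λ _ → ⊤) (cops x) ρ
    follow-nb conf (caught x≡ρ)                  _      _       = caught j (trans (updateAt-updates j C) x≡ρ)
    follow-nb conf (move _ _ x~y _ (inj₁ y≡ρ))   _      _       = j-captures x~y y≡ρ
    follow-nb conf (move _ _ x~y _ (inj₂ next))  v∈hist (inj₁ Sρ) =
      shadow-step conf Sρ x~y λ Hρ' ρ~ρ' → follow-nb conf (next _ Hρ' ρ~ρ') (there v∈hist) Hρ'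
    follow-nb conf (move y _ _ y∉hist (inj₂ next)) v∈hist (inj₂ refl) =
      ⊥-elim (NBWin-visited G (next v (inj₂ refl) (inj₂ refl)) (inj₂ refl) (there v∈hist)
                λ y≡v → y∉hist (subst (_∈ _) (sym y≡v) v∈hist))

    cops-win-through-gate : S r → (∀ w → (NSet G S w × N' G C j w) ⇔ (w ≡ v))
                          → NoBacktrackWinning G H v
                          → CopsWin G (λ _ → ⊤) (cops (C j)) r
    cops-win-through-gate Sr gate (_ , v-wins) =
      shadow-step conf Sr (inj₁ Cj~v) λ Hρ' _ → follow-nb conf (v-wins _ Hρ') (here refl) Hρ'
      where
        Cj~v : Adj G (C j) v
        Cj~v = proj₁ (proj₂ (Equivalence.from (gate v) refl))
        conf : Confines H
        conf = confines inj₁ λ {ρ} {w} Sρ ρ~w ¬Sw N'w →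
          inj₂ (Equivalence.to (gate w) (((ρ , Sρ , ρ~w) , ¬Sw) , N'w))

lemma5 : {n k : ℕ} (G : Graph n) → Connected G
    → (C : Fin k → Fin n) (r : Fin n)
    → Σ (Fin k) (λ j →
        ((∀ s w → Safe G C r s → N' G C j w → ¬ Adj G s w)
          × CopWinGraph G (Safe G C r))
        ⊎ Σ (Fin n) (λ v →
            (∀ w → (NSet G (Safe G C r) w × N' G C j w) ⇔ (w ≡ v))
            × CopWinGraph G (λ x → Safe G C r x ⊎ x ≡ v)
            × NoBacktrackWinning G (λ x → Safe G C r x ⊎ x ≡ v) v))
    → CopsWin G (λ _ → ⊤) C r
lemma5 G conn C r (j , hyp) with InNC-dec G C r
... | yes (i , Ci~r) = capture G C i Ci~r
... | no r∉N[C]      =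
  CopsWin-cong G (updateAt-id-local j C refl)
    ([ (λ (sealed , copwin) → cops-win-if-sealed conn Sr sealed copwin)
     , (λ (v , gate , _ , v-nbw) → cops-win-through-gate v Sr gate v-nbw)
     ]′ hyp)
  where
    open Shadowing G C j r
    Sr : S r
    Sr = here r∉N[C]
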